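{- Let $n\ge2$ be an integer, let $p$ be a prime number, and put $k:=\nu_p(n)$. Let $S_2^n:=\{x_1^n+x_2^n : x_1,x_2\in\mathbb{Z}_{\ge0}\}$ and $R(S_2^n):=\{a/b: a,b\in S_2^n,\ b\neq0\}$. Then $R(S_2^n)$ is dense in $\mathbb{Q}_p$ if and only if $-1$ is an $n$th power modulo $p^{2k+1}$. In particular, $R(S_2^n)$ is dense in $\mathbb{Q}_p$ whenever $n$ is odd.
   Context: $\nu_p$ denotes the $p$-adic valuation. -}

module Defs where

open import Data.Nat using (ℕ; _+_; _^_; NonZero)
open import Data.Nat.Divisibility using (_∣_)
open import Data.Integer using (+_; ∣_∣)
open import Data.Rational using (ℚ; _/_; _-_; ↥_; ↧ₙ_)
open import Data.Product using (Σ; _×_)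
open import Relation.Binary.PropositionalEquality using (_≡_)
open import Relation.Nullary using (¬_)

InS2 : ℕ → ℕ → Set
InS2 n a = Σ ℕ λ x₁ → Σ ℕ λ x₂ → a ≡ x₁ ^ n + x₂ ^ n

-- ν_p(x) ≥ m for a rational x (with ν_p(0) = +∞).  Since ℚ is stored in
-- lowest terms x = u/v (v > 0, gcd(u,v)=1), ν_p(x) ≥ m (m ∈ ℕ) iff
-- p^m ∣ u and p ∤ v.
ValGe : ℕ → ℕ → ℚ → Set
ValGe p m x = (p ^ m ∣ ∣ ↥ x ∣) × ¬ (p ∣ ↧ₙ x)

-- R(S_2^n) = { a/b : a, b ∈ S_2^n, b ≠ 0 } is dense in ℚ_p.
-- Since ℚ is dense in ℚ_p and the balls { y : ν_p(y - q) ≥ m } (q ∈ ℚ, m ∈ ℕ)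
-- form a basis of the topology of ℚ_p, this is equivalent to: every such
-- ball meets R(S_2^n).
DenseInQp : ℕ → ℕ → Set
DenseInQp n p =
  (q : ℚ) (m : ℕ) →
  Σ ℕ λ a → Σ ℕ λ b → InS2 n a × InS2 n b ×
  Σ (NonZero b) λ nz → ValGe p m ((+ a / b) {{nz}} - q)

MinusOneIsNthPowerMod : ℕ → ℕ → Set
MinusOneIsNthPowerMod n N = Σ ℕ λ x → N ∣ x ^ n + 1

{-# OPTIONS --safe #-}
module Submission where

open import Defs
open import Data.Nat using (ℕ; suc; _+_; _*_; _^_; _≤_)
open import Data.Nat.Divisibility using (_∣_)
open import Data.Nat.Primality using (Prime)
open import Data.Product using (_×_)
open import Function.Bundles using (_⇔_)
open import Relation.Nullary using (¬_)

open import Data.Nat.Base using (zero; _∸_; s≤s; z≤n; _<_; ≢-nonZero⁻¹; NonZero; ≢-nonZero; nonTrivial⇒n>1)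
open import Data.Nat.Properties
open import Data.Nat.Divisibility
  using (divides; ∣-trans; ∣-refl; _∣?_; ∣1⇒≡1; _∣0; ∣⇒≤; ∣m+n∣m⇒∣n; *-cancelˡ-∣; ∣m⇒∣m*n; *-monoˡ-∣; *-pres-∣)
open import Data.Nat.Primality using (prime[2]; euclidsLemma; prime⇒nonZero; prime⇒nonTrivial; prime⇒irreducible)
open import Data.Nat.Coprimality as Coprime using (Coprime; 1-coprimeTo; coprime-divisor)
open import Data.Nat.Induction using (Acc; acc; <-wellFounded)
open import Data.Nat.Tactic.RingSolver using () renaming (solve-∀ to solve-ℕ)
open import Data.Integer.Base using (ℤ; +_; -[1+_])
import Data.Integer.Base as ℤ
import Data.Integer.Properties as ℤ
import Data.Integer.Divisibility.Signed as ℤ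
import Data.Integer.DivMod as ℤ
open import Data.Integer.Tactic.RingSolver using () renaming (solve-∀ to solve-ℤ)
import Data.Nat.GCD as GCD
open import Data.Nat.DivMod using (_%_; m<n⇒m%n≡m; [m+kn]%n≡m%n)
open import Data.Rational.Base using (ℚ; mkℚ; ↥_; ↧_; ↧ₙ_; toℚᵘ) renaming (_/_ to _/ℚ_; _-_ to _-ℚ_)
import Data.Rational.Base as ℚ
import Data.Rational.Properties as ℚ
import Data.Rational.Unnormalised.Base as ℚᵘ
import Data.Rational.Unnormalised.Properties as ℚᵘ
open import Data.Product using (Σ; ∃-syntax; _,_; proj₁; proj₂)
open import Data.Sum using (_⊎_; inj₁; inj₂)
open import Data.Empty using (⊥-elim)
open import Relation.Nullary using (Dec; yes; no)
open import Function.Base using (_∘_)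
open import Function.Bundles using (mk⇔; module Equivalence)
open import Relation.Binary.Definitions using (tri<; tri≈; tri>)
open import Relation.Binary.Bundles using (Setoid)
import Relation.Binary.Reasoning.Setoid as SetoidReasoning
open import Level using (0ℓ)
open import Relation.Binary.PropositionalEquality
  using (_≡_; _≢_; refl; sym; trans; cong; cong₂; subst; subst₂; module ≡-Reasoning)

-- Write n = p^k n′ with p ∤ n′, and M = 2k + 1.  If z^n ≡ -1 (mod p^M) then, since the
-- derivative n z^(n-1) has valuation exactly k, Hensel's lemma lifts z to solutions of
-- x^n + 1 ≡ T modulo every power of p, for every T ≡ 0 (mod p^M).  Taking T = p^M u and
-- T = p^M v gives a = x^n + 1 and b = y^n + 1 in S_2^n with a/b p-adically as close to
-- u/v as we like.
-- Conversely, take out the largest power p^v dividing both x₁ and x₂.  Either p^M divides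
-- y₁^n + y₂^n with y₁ a unit, and then -1 ≡ (y₂/y₁)^n (mod p^M), or ν_p(x₁^n + x₂^n) = nv + r
-- with r < M.  For odd p and even n we have n ≥ 2M, so ν_p(a) - ν_p(b) is never ≡ M (mod n)
-- and a/b cannot approximate p^M.  For p = 2 and even n, the odd part of a sum of two squares
-- is 1 mod 4, so a/b cannot approximate 3.  For odd n, -1 is the n-th power of -1.

prime⇒>1 : ∀ {p} → Prime p → 1 < p
prime⇒>1 {p} pr = nonTrivial⇒n>1 p {{prime⇒nonTrivial pr}}

prime≢1 : ∀ {p} → Prime p → p ≢ 1
prime≢1 pr = >⇒≢ (prime⇒>1 pr)

prime∤1 : ∀ {p} → Prime p → ¬ p ∣ 1
prime∤1 pr p∣1 = prime≢1 pr (∣1⇒≡1 p∣1)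

prime∤⇒coprime : ∀ {p n} → Prime p → ¬ p ∣ n → Coprime p n
prime∤⇒coprime pr p∤n (d∣p , d∣n) with prime⇒irreducible pr d∣p
... | inj₁ d≡1 = d≡1
... | inj₂ refl = ⊥-elim (p∤n d∣n)

coprime-^ : ∀ {m n} j → Coprime m n → Coprime (m ^ j) n
coprime-^ zero c = 1-coprimeTo _
coprime-^ {m} (suc j) c (d∣m*mʲ , d∣n) =
  coprime-^ j c (coprime-divisor d⊥m d∣m*mʲ , d∣n)
  where
    d⊥m : Coprime _ m
    d⊥m (e∣d , e∣m) = c (e∣m , ∣-trans e∣d d∣n)

prime∤-^ : ∀ {p x} j → Prime p → ¬ p ∣ x → ¬ p ∣ x ^ j
prime∤-^ j pr p∤x p∣xʲ =
  prime≢1 pr (coprime-^ j (Coprime.sym (prime∤⇒coprime pr p∤x)) (p∣xʲ , ∣-refl))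

prime∤-* : ∀ {p x y} → Prime p → ¬ p ∣ x → ¬ p ∣ y → ¬ p ∣ x * y
prime∤-* {x = x} {y} pr p∤x p∤y p∣xy with euclidsLemma x y pr p∣xy
... | inj₁ p∣x = p∤x p∣x
... | inj₂ p∣y = p∤y p∣y

^-∣-^ : ∀ p {e f} → e ≤ f → p ^ e ∣ p ^ f
^-∣-^ p {e} {f} e≤f = divides (p ^ (f ∸ e)) (begin
  p ^ f               ≡⟨ cong (p ^_) (m+[n∸m]≡n e≤f) ⟨
  p ^ (e + (f ∸ e))   ≡⟨ ^-distribˡ-+-* p e (f ∸ e) ⟩
  p ^ e * p ^ (f ∸ e) ≡⟨ *-comm (p ^ e) _ ⟩
  p ^ (f ∸ e) * p ^ e ∎)
  where open ≡-Reasoning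

^-distribʳ-* : ∀ x y n → (x * y) ^ n ≡ x ^ n * y ^ n
^-distribʳ-* x y zero    = refl
^-distribʳ-* x y (suc n) = trans (cong (x * y *_) (^-distribʳ-* x y n)) (lemma x y (x ^ n) (y ^ n))
  where
    lemma : ∀ a b c d → a * b * (c * d) ≡ a * c * (b * d)
    lemma = solve-ℕ

infix 4 _^_∥_
record _^_∥_ (p e x : ℕ) : Set where
  constructor mk∥
  field
    cofactor   : ℕ
    factorises : x ≡ p ^ e * cofactor
    p∤cofactor : ¬ p ∣ cofactor

^-∥ : ∀ {p} e → Prime p → p ^ e ∥ p ^ e
^-∥ {p} e pr = mk∥ 1 (sym (*-identityʳ (p ^ e))) (prime∤1 pr)

∥-* : ∀ {p e f x y} → Prime p → p ^ e ∥ x → p ^ f ∥ y → p ^ (e + f) ∥ x * y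
∥-* {p} {e} {f} pr (mk∥ u refl p∤u) (mk∥ w refl p∤w) =
  mk∥ (u * w) eq (prime∤-* pr p∤u p∤w)
  where
    eq : p ^ e * u * (p ^ f * w) ≡ p ^ (e + f) * (u * w)
    eq = trans (lemma (p ^ e) u (p ^ f) w) (cong (_* (u * w)) (sym (^-distribˡ-+-* p e f)))
      where
        lemma : ∀ a b c d → a * b * (c * d) ≡ a * c * (b * d)
        lemma = solve-ℕ

∥⇒∣ : ∀ {p e x} → p ^ e ∥ x → p ^ e ∣ x
∥⇒∣ {p} {e} (mk∥ u refl _) = divides u (*-comm (p ^ e) u)

∥⇒∤ : ∀ {p e x} .{{_ : NonZero p}} → p ^ e ∥ x → ¬ p ^ suc e ∣ x
∥⇒∤ {p} {e} (mk∥ u refl p∤u) p^1+e∣x =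
  p∤u (*-cancelˡ-∣ (p ^ e) {{m^n≢0 p e}} (subst (_∣ p ^ e * u) (*-comm p (p ^ e)) p^1+e∣x))

∥-unique : ∀ {p e f x} .{{_ : NonZero p}} → p ^ e ∥ x → p ^ f ∥ x → e ≡ f
∥-unique {p} {e} {f} pᵉ∥x pᶠ∥x with <-cmp e f
... | tri< e<f _ _ = ⊥-elim (∥⇒∤ pᵉ∥x (∣-trans (^-∣-^ p e<f) (∥⇒∣ pᶠ∥x)))
... | tri≈ _ e≡f _ = e≡f
... | tri> _ _ f<e = ⊥-elim (∥⇒∤ pᶠ∥x (∣-trans (^-∣-^ p f<e) (∥⇒∣ pᵉ∥x)))

∥⇒≢0 : ∀ {p e x} → Prime p → p ^ e ∥ x → x ≢ 0
∥⇒≢0 {p} {e} pr (mk∥ u refl p∤u) pᵉu≡0 = p∤u (subst (p ∣_) (sym u≡0) (p ∣0))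
  where
    u≡0 : u ≡ 0
    u≡0 = m*n≡0⇒m≡0 u (p ^ e) {{m^n≢0 p e {{prime⇒nonZero pr}}}} (trans (*-comm u (p ^ e)) pᵉu≡0)

common-power : ∀ {p} → Prime p → ∀ x y → x + y ≢ 0 →
  ∃[ v ] ∃[ x′ ] ∃[ y′ ] x ≡ p ^ v * x′ × y ≡ p ^ v * y′ × (¬ p ∣ x′ ⊎ ¬ p ∣ y′)
common-power {p} pr x y x+y≢0 = go x y x+y≢0 (<-wellFounded (x + y))
  where
    go : ∀ x y → x + y ≢ 0 → Acc _<_ (x + y) →
      ∃[ v ] ∃[ x′ ] ∃[ y′ ] x ≡ p ^ v * x′ × y ≡ p ^ v * y′ × (¬ p ∣ x′ ⊎ ¬ p ∣ y′)
    go x y _ _ with p ∣? x | p ∣? y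
    go x y _ _ | no p∤x | _ = 0 , x , y , sym (*-identityˡ x) , sym (*-identityˡ y) , inj₁ p∤x
    go x y _ _ | yes _ | no p∤y = 0 , x , y , sym (*-identityˡ x) , sym (*-identityˡ y) , inj₂ p∤y
    go _ _ x+y≢0 (acc rec) | yes (divides x₁ refl) | yes (divides y₁ refl)
      with go x₁ y₁ x₁+y₁≢0 (rec x₁+y₁<x+y)
      where
        x+y≡[x₁+y₁]p : x₁ * p + y₁ * p ≡ (x₁ + y₁) * p
        x+y≡[x₁+y₁]p = sym (*-distribʳ-+ p x₁ y₁)
        x₁+y₁≢0 : x₁ + y₁ ≢ 0
        x₁+y₁≢0 eq = x+y≢0 (trans x+y≡[x₁+y₁]p (cong (_* p) eq))
        x₁+y₁<x+y : x₁ + y₁ < x₁ * p + y₁ * p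
        x₁+y₁<x+y = subst (x₁ + y₁ <_) (sym x+y≡[x₁+y₁]p)
          (m<m*n (x₁ + y₁) p {{≢-nonZero x₁+y₁≢0}} (prime⇒>1 pr))
    ... | v , x′ , y′ , refl , refl , p∤x′⊎p∤y′ = suc v , x′ , y′ , shift x′ , shift y′ , p∤x′⊎p∤y′
      where
        shift : ∀ z → p ^ v * z * p ≡ p * p ^ v * z
        shift z = lemma (p ^ v) z p
          where
            lemma : ∀ a b c → a * b * c ≡ c * a * b
            lemma = solve-ℕ

∃-∥ : ∀ {p x} → Prime p → x ≢ 0 → ∃[ e ] p ^ e ∥ x
∃-∥ {p} {x} pr x≢0 with common-power pr x x (x≢0 ∘ m+n≡0⇒m≡0 x)
... | e , u , _ , x≡pᵉu , _ , inj₁ p∤u = e , mk∥ u x≡pᵉu p∤u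
... | e , _ , w , _ , x≡pᵉw , inj₂ p∤w = e , mk∥ w x≡pᵉw p∤w

infix 4 _≡_mod_
record _≡_mod_ (x y : ℤ) (m : ℕ) : Set where
  constructor ≡-mod
  field
    quotient : ℤ
    equality : x ℤ.- y ≡ quotient ℤ.* + m

module _ {m : ℕ} where
  ≡-mod-refl : ∀ {x} → x ≡ x mod m
  ≡-mod-refl {x} = ≡-mod (+ 0) (lemma x (+ m))
    where
      lemma : ∀ x m → x ℤ.- x ≡ + 0 ℤ.* m
      lemma = solve-ℤ

  ≡-mod-sym : ∀ {x y} → x ≡ y mod m → y ≡ x mod m
  ≡-mod-sym {x} {y} (≡-mod q eq) =
    ≡-mod (ℤ.- q) (trans (lemma x y) (trans (cong ℤ.-_ eq) (ℤ.neg-distribˡ-* q (+ m))))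
    where
      lemma : ∀ x y → y ℤ.- x ≡ ℤ.- (x ℤ.- y)
      lemma = solve-ℤ

  ≡-mod-trans : ∀ {x y z} → x ≡ y mod m → y ≡ z mod m → x ≡ z mod m
  ≡-mod-trans {x} {y} {z} (≡-mod q eq) (≡-mod r eq′) = ≡-mod (q ℤ.+ r) (begin
    x ℤ.- z                         ≡⟨ lemma₁ x y z ⟩
    (x ℤ.- y) ℤ.+ (y ℤ.- z)         ≡⟨ cong₂ ℤ._+_ eq eq′ ⟩
    q ℤ.* + m ℤ.+ r ℤ.* + m         ≡⟨ lemma₂ q r (+ m) ⟩
    (q ℤ.+ r) ℤ.* + m               ∎)
    where
      open ≡-Reasoning
      lemma₁ : ∀ x y z → x ℤ.- z ≡ (x ℤ.- y) ℤ.+ (y ℤ.- z)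
      lemma₁ = solve-ℤ
      lemma₂ : ∀ q r m → q ℤ.* m ℤ.+ r ℤ.* m ≡ (q ℤ.+ r) ℤ.* m
      lemma₂ = solve-ℤ

  ≡-mod-+ : ∀ {x y u v} → x ≡ y mod m → u ≡ v mod m → x ℤ.+ u ≡ y ℤ.+ v mod m
  ≡-mod-+ {x} {y} {u} {v} (≡-mod q eq) (≡-mod r eq′) = ≡-mod (q ℤ.+ r) (begin
    x ℤ.+ u ℤ.- (y ℤ.+ v)           ≡⟨ lemma₁ x y u v ⟩
    (x ℤ.- y) ℤ.+ (u ℤ.- v)         ≡⟨ cong₂ ℤ._+_ eq eq′ ⟩
    q ℤ.* + m ℤ.+ r ℤ.* + m         ≡⟨ lemma₂ q r (+ m) ⟩
    (q ℤ.+ r) ℤ.* + m               ∎)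
    where
      open ≡-Reasoning
      lemma₁ : ∀ x y u v → x ℤ.+ u ℤ.- (y ℤ.+ v) ≡ (x ℤ.- y) ℤ.+ (u ℤ.- v)
      lemma₁ = solve-ℤ
      lemma₂ : ∀ q r m → q ℤ.* m ℤ.+ r ℤ.* m ≡ (q ℤ.+ r) ℤ.* m
      lemma₂ = solve-ℤ

  ≡-mod-- : ∀ {x y u v} → x ≡ y mod m → u ≡ v mod m → x ℤ.- u ≡ y ℤ.- v mod m
  ≡-mod-- {x} {y} {u} {v} (≡-mod q eq) (≡-mod r eq′) = ≡-mod (q ℤ.- r) (begin
    x ℤ.- u ℤ.- (y ℤ.- v)           ≡⟨ lemma₁ x y u v ⟩
    (x ℤ.- y) ℤ.- (u ℤ.- v)         ≡⟨ cong₂ ℤ._-_ eq eq′ ⟩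
    q ℤ.* + m ℤ.- r ℤ.* + m         ≡⟨ lemma₂ q r (+ m) ⟩
    (q ℤ.- r) ℤ.* + m               ∎)
    where
      open ≡-Reasoning
      lemma₁ : ∀ x y u v → x ℤ.- u ℤ.- (y ℤ.- v) ≡ (x ℤ.- y) ℤ.- (u ℤ.- v)
      lemma₁ = solve-ℤ
      lemma₂ : ∀ q r m → q ℤ.* m ℤ.- r ℤ.* m ≡ (q ℤ.- r) ℤ.* m
      lemma₂ = solve-ℤ

  ≡-mod-* : ∀ {x y u v} → x ≡ y mod m → u ≡ v mod m → x ℤ.* u ≡ y ℤ.* v mod m
  ≡-mod-* {x} {y} {u} {v} (≡-mod q eq) (≡-mod r eq′) = ≡-mod (q ℤ.* u ℤ.+ y ℤ.* r) (begin
    x ℤ.* u ℤ.- y ℤ.* v                   ≡⟨ lemma₁ x y u v ⟩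
    (x ℤ.- y) ℤ.* u ℤ.+ y ℤ.* (u ℤ.- v)   ≡⟨ cong₂ (λ a b → a ℤ.* u ℤ.+ y ℤ.* b) eq eq′ ⟩
    q ℤ.* + m ℤ.* u ℤ.+ y ℤ.* (r ℤ.* + m) ≡⟨ lemma₂ q r u y (+ m) ⟩
    (q ℤ.* u ℤ.+ y ℤ.* r) ℤ.* + m         ∎)
    where
      open ≡-Reasoning
      lemma₁ : ∀ x y u v → x ℤ.* u ℤ.- y ℤ.* v ≡ (x ℤ.- y) ℤ.* u ℤ.+ y ℤ.* (u ℤ.- v)
      lemma₁ = solve-ℤ
      lemma₂ : ∀ q r u y m → q ℤ.* m ℤ.* u ℤ.+ y ℤ.* (r ℤ.* m) ≡ (q ℤ.* u ℤ.+ y ℤ.* r) ℤ.* m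
      lemma₂ = solve-ℤ

  ≡-mod-^ : ∀ {x y} n → x ≡ y mod m → x ℤ.^ n ≡ y ℤ.^ n mod m
  ≡-mod-^ zero    x≡y = ≡-mod-refl
  ≡-mod-^ (suc n) x≡y = ≡-mod-* x≡y (≡-mod-^ n x≡y)

  ≡-mod-∣ : ∀ {d x y} → d ∣ m → x ≡ y mod m → x ≡ y mod d
  ≡-mod-∣ {d} {x} {y} (divides e refl) (≡-mod q eq) =
    ≡-mod (q ℤ.* + e) (trans eq (trans (cong (q ℤ.*_) (ℤ.pos-* e d)) (sym (ℤ.*-assoc q (+ e) (+ d)))))

  ≡-mod⇒∣ : ∀ {x y} → x ≡ y mod m → m ∣ ℤ.∣ x ℤ.- y ∣
  ≡-mod⇒∣ (≡-mod q eq) = ℤ.∣⇒∣ᵤ (ℤ.divides q eq)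

  ∣⇒≡-mod : ∀ {x y} → m ∣ ℤ.∣ x ℤ.- y ∣ → x ≡ y mod m
  ∣⇒≡-mod m∣x-y with ℤ.∣ᵤ⇒∣ {+ m} m∣x-y
  ... | ℤ.divides q eq = ≡-mod q eq

  ∃-representative : .{{_ : NonZero m}} → ∀ x → ∃[ r ] x ≡ + r mod m
  ∃-representative x = x ℤ.%ℕ m , ≡-mod (x ℤ./ℕ m) (begin
    x ℤ.- + (x ℤ.%ℕ m)                                           ≡⟨ cong (ℤ._- r) (ℤ.a≡a%ℕn+[a/ℕn]*n x m) ⟩
    r ℤ.+ (x ℤ./ℕ m) ℤ.* + m ℤ.- r                               ≡⟨ lemma r (x ℤ./ℕ m) (+ m) ⟩
    (x ℤ./ℕ m) ℤ.* + m                                           ∎)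
    where
      open ≡-Reasoning
      r = + (x ℤ.%ℕ m)
      lemma : ∀ r q m → r ℤ.+ q ℤ.* m ℤ.- r ≡ q ℤ.* m
      lemma = solve-ℤ

≡-mod-reflexive : ∀ {x y m} → x ≡ y → x ≡ y mod m
≡-mod-reflexive refl = ≡-mod-refl

≡-mod-setoid : ℕ → Setoid 0ℓ 0ℓ
≡-mod-setoid m = record
  { Carrier       = ℤ
  ; _≈_           = λ x y → x ≡ y mod m
  ; isEquivalence = record { refl = ≡-mod-refl ; sym = ≡-mod-sym ; trans = ≡-mod-trans }
  }

module ≡-mod-Reasoning (m : ℕ) = SetoidReasoning (≡-mod-setoid m)

≡-mod-sub-one : ∀ {A T m} → A ℤ.+ + 1 ≡ T mod m → A ≡ T ℤ.- + 1 mod m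
≡-mod-sub-one {A} {T} (≡-mod q eq) = ≡-mod q (trans (lemma A T) eq)
  where
    lemma : ∀ A T → A ℤ.- (T ℤ.- + 1) ≡ A ℤ.+ + 1 ℤ.- T
    lemma = solve-ℤ

≡-mod-add-one : ∀ {A T m} → A ≡ T ℤ.- + 1 mod m → A ℤ.+ + 1 ≡ T mod m
≡-mod-add-one {A} {T} (≡-mod q eq) = ≡-mod q (trans (lemma A T) eq)
  where
    lemma : ∀ A T → A ℤ.+ + 1 ℤ.- T ≡ A ℤ.- (T ℤ.- + 1)
    lemma = solve-ℤ

≡-mod-cancel : ∀ d {u w m} .{{_ : NonZero d}} → + (d * u) ≡ + (d * w) mod d * m → + u ≡ + w mod m
≡-mod-cancel d {u} {w} {m} (≡-mod q eq) = ≡-mod q (ℤ.*-cancelˡ-≡ (+ d) _ _ {{d≢0}} (begin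
  + d ℤ.* (+ u ℤ.- + w)               ≡⟨ lemma₁ (+ d) (+ u) (+ w) ⟩
  + d ℤ.* + u ℤ.- + d ℤ.* + w         ≡⟨ cong₂ ℤ._-_ (ℤ.pos-* d u) (ℤ.pos-* d w) ⟨
  + (d * u) ℤ.- + (d * w)             ≡⟨ eq ⟩
  q ℤ.* + (d * m)                     ≡⟨ cong (q ℤ.*_) (ℤ.pos-* d m) ⟩
  q ℤ.* (+ d ℤ.* + m)                 ≡⟨ lemma₂ q (+ d) (+ m) ⟩
  + d ℤ.* (q ℤ.* + m)                 ∎))
  where
    open ≡-Reasoning
    d≢0 : ℤ.NonZero (+ d)
    d≢0 = ≢-nonZero (≢-nonZero⁻¹ d)
    lemma₁ : ∀ d x y → d ℤ.* (x ℤ.- y) ≡ d ℤ.* x ℤ.- d ℤ.* y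
    lemma₁ = solve-ℤ
    lemma₂ : ∀ q d m → q ℤ.* (d ℤ.* m) ≡ d ℤ.* (q ℤ.* m)
    lemma₂ = solve-ℤ

multiple≡0-mod : ∀ {d m} q → d ∣ m → q ℤ.* + m ≡ + 0 mod d
multiple≡0-mod {d} {m} q d∣m = ≡-mod-∣ d∣m (≡-mod q (ℤ.+-identityʳ (q ℤ.* + m)))

+-*-≡-mod : ∀ r m k → + (r + m * k) ≡ + r mod m
+-*-≡-mod r m k = ≡-mod (+ k) (begin
  + (r + m * k) ℤ.- + r          ≡⟨ cong (ℤ._- + r) (trans (ℤ.pos-+ r (m * k)) (cong (ℤ._+_ (+ r)) (ℤ.pos-* m k))) ⟩
  + r ℤ.+ + m ℤ.* + k ℤ.- + r     ≡⟨ lemma (+ r) (+ m) (+ k) ⟩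
  + k ℤ.* + m                    ∎)
  where
    open ≡-Reasoning
    lemma : ∀ r m k → r ℤ.+ m ℤ.* k ℤ.- r ≡ k ℤ.* m
    lemma = solve-ℤ

∣-cong-mod : ∀ {m x y} → x ≡ y mod m → m ∣ ℤ.∣ y ∣ → m ∣ ℤ.∣ x ∣
∣-cong-mod {m} {x} {y} (≡-mod q eq) m∣y = ℤ.∣⇒∣ᵤ (subst (+ m ℤ.∣_) (lemma x y) m∣x-y+y)
  where
    m∣x-y+y : + m ℤ.∣ (x ℤ.- y) ℤ.+ y
    m∣x-y+y = ℤ.∣m∣n⇒∣m+n (ℤ.divides q eq) (ℤ.∣ᵤ⇒∣ m∣y)
    lemma : ∀ x y → (x ℤ.- y) ℤ.+ y ≡ x
    lemma = solve-ℤ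

≡0-mod⇒∣ℤ : ∀ {m x} → x ≡ + 0 mod m → m ∣ ℤ.∣ x ∣
≡0-mod⇒∣ℤ x≡0 = ∣-cong-mod x≡0 (_ ∣0)

∣⇒≡0-mod : ∀ {m x} → m ∣ x → + x ≡ + 0 mod m
∣⇒≡0-mod {m} {x} (divides q refl) = ≡-mod (+ q) (trans (ℤ.+-identityʳ (+ (q * m))) (ℤ.pos-* q m))

∥-cong : ∀ {p f ℓ x y} → Prime p → f < ℓ → + x ≡ + y mod p ^ ℓ → p ^ f ∥ y → p ^ f ∥ x
∥-cong {p} {f} {ℓ} pr f<ℓ x≡y pᶠ∥y
  with ∣-cong-mod (≡-mod-∣ (^-∣-^ p (<⇒≤ f<ℓ)) x≡y) (∥⇒∣ pᶠ∥y)
... | divides u refl = mk∥ u (*-comm u (p ^ f)) p∤u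
  where
    instance _ = prime⇒nonZero pr
    p∤u : ¬ p ∣ u
    p∤u p∣u = ∥⇒∤ pᶠ∥y (∣-cong-mod (≡-mod-∣ (^-∣-^ p f<ℓ) (≡-mod-sym x≡y)) (*-monoˡ-∣ (p ^ f) p∣u))

pos-^ : ∀ m n → + (m ^ n) ≡ (+ m) ℤ.^ n
pos-^ m zero    = refl
pos-^ m (suc n) = trans (ℤ.pos-* m (m ^ n)) (cong (+ m ℤ.*_) (pos-^ m n))

abs-^ : ∀ x n → ℤ.∣ x ℤ.^ n ∣ ≡ ℤ.∣ x ∣ ^ n
abs-^ x zero    = refl
abs-^ x (suc n) = trans (ℤ.abs-* x (x ℤ.^ n)) (cong (ℤ.∣ x ∣ *_) (abs-^ x n))

ℤ^-distribʳ-* : ∀ x y n → (x ℤ.* y) ℤ.^ n ≡ x ℤ.^ n ℤ.* y ℤ.^ n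
ℤ^-distribʳ-* x y zero    = refl
ℤ^-distribʳ-* x y (suc n) = trans (cong (x ℤ.* y ℤ.*_) (ℤ^-distribʳ-* x y n)) (lemma x y (x ℤ.^ n) (y ℤ.^ n))
  where
    lemma : ∀ a b c d → a ℤ.* b ℤ.* (c ℤ.* d) ≡ a ℤ.* c ℤ.* (b ℤ.* d)
    lemma = solve-ℤ

power-plus-one : ∀ {n} x → (+ x) ℤ.^ n ℤ.+ + 1 ≡ + (x ^ n + 1)
power-plus-one {n} x = sym (trans (ℤ.pos-+ (x ^ n) 1) (cong (ℤ._+ + 1) (pos-^ x n)))

-- Inverses and Hensel lifting

∃-inverse : ∀ {g m} → Coprime g m → ∃[ c ] + g ℤ.* c ≡ + 1 mod m
∃-inverse {g} {m} g⊥m with Coprime.coprime-Bézout g⊥m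
... | GCD.Bézout.+- x y eq = + x , ≡-mod (+ y) (begin
  + g ℤ.* + x ℤ.- + 1             ≡⟨ cong (ℤ._- + 1) (trans (ℤ.*-comm (+ g) (+ x)) (sym (ℤ.pos-* x g))) ⟩
  + (x * g) ℤ.- + 1               ≡⟨ cong (λ z → + z ℤ.- + 1) eq ⟨
  + (1 + y * m) ℤ.- + 1           ≡⟨ cong (ℤ._- + 1) (ℤ.pos-+ 1 (y * m)) ⟩
  + 1 ℤ.+ + (y * m) ℤ.- + 1       ≡⟨ lemma (+ 1) (+ (y * m)) ⟩
  + (y * m)                       ≡⟨ ℤ.pos-* y m ⟩
  + y ℤ.* + m                     ∎)
  where
    open ≡-Reasoning
    lemma : ∀ a b → a ℤ.+ b ℤ.- a ≡ b
    lemma = solve-ℤ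
... | GCD.Bézout.-+ x y eq = ℤ.- + x , ≡-mod (ℤ.- + y) (begin
  + g ℤ.* (ℤ.- + x) ℤ.- + 1       ≡⟨ lemma (+ g) (+ x) ⟩
  ℤ.- (+ 1 ℤ.+ + x ℤ.* + g)       ≡⟨ cong (λ z → ℤ.- (+ 1 ℤ.+ z)) (ℤ.pos-* x g) ⟨
  ℤ.- + (1 + x * g)               ≡⟨ cong (λ z → ℤ.- + z) eq ⟩
  ℤ.- + (y * m)                   ≡⟨ cong ℤ.-_ (ℤ.pos-* y m) ⟩
  ℤ.- (+ y ℤ.* + m)               ≡⟨ ℤ.neg-distribˡ-* (+ y) (+ m) ⟩
  ℤ.- + y ℤ.* + m                 ∎)
  where
    open ≡-Reasoning
    lemma : ∀ g x → g ℤ.* (ℤ.- x) ℤ.- + 1 ≡ ℤ.- (+ 1 ℤ.+ x ℤ.* g)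
    lemma = solve-ℤ

∃-inverseℤ : ∀ {G m} → Coprime ℤ.∣ G ∣ m → ∃[ c ] G ℤ.* c ≡ + 1 mod m
∃-inverseℤ {+ g} G⊥m = ∃-inverse G⊥m
∃-inverseℤ { -[1+ g ]} G⊥m with ∃-inverse G⊥m
... | c , ≡-mod q eq = ℤ.- c , ≡-mod q (trans (cong (ℤ._- + 1) (lemma (+ suc g) c)) eq)
  where
    lemma : ∀ g c → (ℤ.- g) ℤ.* (ℤ.- c) ≡ g ℤ.* c
    lemma = solve-ℤ

unit-inverse : ∀ {p G} → Prime p → ¬ p ∣ ℤ.∣ G ∣ → ∀ j → ∃[ c ] G ℤ.* c ≡ + 1 mod p ^ j
unit-inverse {G = G} pr p∤G j = ∃-inverseℤ {G} (Coprime.sym (coprime-^ j (prime∤⇒coprime pr p∤G)))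

binomial-remainder : ∀ X h n → ∃[ R ]
  (X ℤ.+ h) ℤ.^ suc n ≡ X ℤ.^ suc n ℤ.+ + suc n ℤ.* X ℤ.^ n ℤ.* h ℤ.+ h ℤ.* h ℤ.* R
binomial-remainder X h zero = + 0 , lemma X h
  where
    lemma : ∀ X h → (X ℤ.+ h) ℤ.* + 1 ≡ X ℤ.* + 1 ℤ.+ + 1 ℤ.* + 1 ℤ.* h ℤ.+ h ℤ.* h ℤ.* + 0
    lemma = solve-ℤ
binomial-remainder X h (suc n) with binomial-remainder X h n
... | R , eq = X ℤ.* R ℤ.+ + suc n ℤ.* X ℤ.^ n ℤ.+ h ℤ.* R ,
               trans (cong ((X ℤ.+ h) ℤ.*_) eq) (lemma X h (X ℤ.^ n) (+ suc n) R)
  where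
    lemma : ∀ X h Xⁿ c R →
      (X ℤ.+ h) ℤ.* (X ℤ.* Xⁿ ℤ.+ c ℤ.* Xⁿ ℤ.* h ℤ.+ h ℤ.* h ℤ.* R) ≡
      X ℤ.* (X ℤ.* Xⁿ) ℤ.+ (+ 1 ℤ.+ c) ℤ.* (X ℤ.* Xⁿ) ℤ.* h ℤ.+ h ℤ.* h ℤ.* (X ℤ.* R ℤ.+ c ℤ.* Xⁿ ℤ.+ h ℤ.* R)
    lemma = solve-ℤ

module Hensel {p k n₁ n′ : ℕ} (pr : Prime p) (n≡pᵏn′ : suc n₁ ≡ p ^ k * n′) (p∤n′ : ¬ p ∣ n′)
              (C : ℤ) where

  private
    pos-^-+ : ∀ a b → + (p ^ (a + b)) ≡ + (p ^ a) ℤ.* + (p ^ b)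
    pos-^-+ a b = trans (cong +_ (^-distribˡ-+-* p a b)) (ℤ.pos-* (p ^ a) (p ^ b))

  first-order-term : ∀ {e} X D c f → X ℤ.^ suc n₁ ℤ.- C ≡ D ℤ.* + (p ^ (k + e)) →
    + n′ ℤ.* X ℤ.^ n₁ ℤ.* c ℤ.- + 1 ≡ f ℤ.* + p →
    X ℤ.^ suc n₁ ℤ.+ + suc n₁ ℤ.* X ℤ.^ n₁ ℤ.* (ℤ.- (D ℤ.* c) ℤ.* + (p ^ e)) ≡ C mod p ^ (k + suc e)
  first-order-term {e} X D c f Xⁿ-C≡Dpᵏ⁺ᵉ Gc-1≡fp = ≡-mod (ℤ.- (D ℤ.* f)) (begin
    Xⁿ ℤ.+ + suc n₁ ℤ.* Y ℤ.* h ℤ.- C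
      ≡⟨ cong (λ N → Xⁿ ℤ.+ N ℤ.* Y ℤ.* h ℤ.- C) (trans (cong +_ n≡pᵏn′) (ℤ.pos-* (p ^ k) n′)) ⟩
    Xⁿ ℤ.+ Pᵏ ℤ.* + n′ ℤ.* Y ℤ.* h ℤ.- C
      ≡⟨ lemma₁ Xⁿ C (+ n′) Y D c Pᵏ Pᵉ ⟩
    (Xⁿ ℤ.- C) ℤ.- D ℤ.* (Pᵏ ℤ.* Pᵉ) ℤ.* (G ℤ.* c)
      ≡⟨ cong (ℤ._- D ℤ.* (Pᵏ ℤ.* Pᵉ) ℤ.* (G ℤ.* c)) (trans Xⁿ-C≡Dpᵏ⁺ᵉ (cong (D ℤ.*_) (pos-^-+ k e))) ⟩
    D ℤ.* (Pᵏ ℤ.* Pᵉ) ℤ.- D ℤ.* (Pᵏ ℤ.* Pᵉ) ℤ.* (G ℤ.* c)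
      ≡⟨ lemma₂ D (Pᵏ ℤ.* Pᵉ) (G ℤ.* c) ⟩
    ℤ.- D ℤ.* (Pᵏ ℤ.* Pᵉ) ℤ.* (G ℤ.* c ℤ.- + 1)
      ≡⟨ cong (ℤ.- D ℤ.* (Pᵏ ℤ.* Pᵉ) ℤ.*_) Gc-1≡fp ⟩
    ℤ.- D ℤ.* (Pᵏ ℤ.* Pᵉ) ℤ.* (f ℤ.* + p)
      ≡⟨ lemma₃ D f Pᵏ Pᵉ (+ p) ⟩
    ℤ.- (D ℤ.* f) ℤ.* (Pᵏ ℤ.* (+ p ℤ.* Pᵉ))
      ≡⟨ cong (ℤ.- (D ℤ.* f) ℤ.*_) (trans (pos-^-+ k (suc e)) (cong (Pᵏ ℤ.*_) (ℤ.pos-* p (p ^ e)))) ⟨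
    ℤ.- (D ℤ.* f) ℤ.* + (p ^ (k + suc e)) ∎)
    where
      open ≡-Reasoning
      Xⁿ = X ℤ.^ suc n₁
      Y = X ℤ.^ n₁
      G = + n′ ℤ.* Y
      Pᵏ = + (p ^ k)
      Pᵉ = + (p ^ e)
      h = ℤ.- (D ℤ.* c) ℤ.* Pᵉ
      lemma₁ : ∀ A C N′ Y D c Pᵏ Pᵉ →
        A ℤ.+ Pᵏ ℤ.* N′ ℤ.* Y ℤ.* (ℤ.- (D ℤ.* c) ℤ.* Pᵉ) ℤ.- C ≡
        (A ℤ.- C) ℤ.- D ℤ.* (Pᵏ ℤ.* Pᵉ) ℤ.* (N′ ℤ.* Y ℤ.* c)
      lemma₁ = solve-ℤ
      lemma₂ : ∀ D Q Y → D ℤ.* Q ℤ.- D ℤ.* Q ℤ.* Y ≡ ℤ.- D ℤ.* Q ℤ.* (Y ℤ.- + 1)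
      lemma₂ = solve-ℤ
      lemma₃ : ∀ D f Pᵏ Pᵉ P →
        ℤ.- D ℤ.* (Pᵏ ℤ.* Pᵉ) ℤ.* (f ℤ.* P) ≡ ℤ.- (D ℤ.* f) ℤ.* (Pᵏ ℤ.* (P ℤ.* Pᵉ))
      lemma₃ = solve-ℤ

  -- Newton's step: X^(n-1) is a unit and n = p^k n′, so correcting X by p^e times
  -- -D (n′ X^(n-1))⁻¹ cancels the error D p^(k+e) modulo p^(k+e+1), while the
  -- quadratic term is divisible by p^(2e), which is enough because e > k.
  step : ∀ {e} X → k < e → ¬ p ∣ ℤ.∣ X ∣ → X ℤ.^ suc n₁ ≡ C mod p ^ (k + e) →
         ∃[ X′ ] ¬ p ∣ ℤ.∣ X′ ∣ × X′ ℤ.^ suc n₁ ≡ C mod p ^ (k + suc e)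
  step {e} X k<e p∤X (≡-mod D Xⁿ-C≡Dpᵏ⁺ᵉ) = X ℤ.+ h , p∤X+h , (begin
    (X ℤ.+ h) ℤ.^ suc n₁                                                  ≡⟨ expand ⟩
    X ℤ.^ suc n₁ ℤ.+ + suc n₁ ℤ.* X ℤ.^ n₁ ℤ.* h ℤ.+ h ℤ.* h ℤ.* R        ≈⟨ ≡-mod-+ linear quadratic ⟩
    C ℤ.+ + 0                                                             ≡⟨ ℤ.+-identityʳ C ⟩
    C                                                                     ∎)
    where
      open ≡-mod-Reasoning (p ^ (k + suc e))
      Pᵉ = + (p ^ e)
      G = + n′ ℤ.* X ℤ.^ n₁
      p∤G : ¬ p ∣ ℤ.∣ G ∣
      p∤G = prime∤-* pr p∤n′ (prime∤-^ n₁ pr p∤X) ∘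
            subst (p ∣_) (trans (ℤ.abs-* (+ n′) (X ℤ.^ n₁)) (cong (n′ *_) (abs-^ X n₁)))
      inverse : ∃[ c ] G ℤ.* c ≡ + 1 mod p
      inverse = ∃-inverseℤ {G} (Coprime.sym (prime∤⇒coprime pr p∤G))
      c = proj₁ inverse
      t = ℤ.- (D ℤ.* c)
      h = t ℤ.* Pᵉ
      R = proj₁ (binomial-remainder X h n₁)
      expand : (X ℤ.+ h) ℤ.^ suc n₁ ≡ X ℤ.^ suc n₁ ℤ.+ + suc n₁ ℤ.* X ℤ.^ n₁ ℤ.* h ℤ.+ h ℤ.* h ℤ.* R
      expand = proj₂ (binomial-remainder X h n₁)
      linear : X ℤ.^ suc n₁ ℤ.+ + suc n₁ ℤ.* X ℤ.^ n₁ ℤ.* h ≡ C mod p ^ (k + suc e)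
      linear = first-order-term X D c (quotient (proj₂ inverse)) Xⁿ-C≡Dpᵏ⁺ᵉ (equality (proj₂ inverse))
        where open _≡_mod_
      quadratic : h ℤ.* h ℤ.* R ≡ + 0 mod p ^ (k + suc e)
      quadratic = ≡-mod-trans (≡-mod-reflexive h²R≡) (multiple≡0-mod (t ℤ.* t ℤ.* R) pᵏ⁺¹⁺ᵉ∣p²ᵉ)
        where
          lemma : ∀ t Pᵉ R → t ℤ.* Pᵉ ℤ.* (t ℤ.* Pᵉ) ℤ.* R ≡ t ℤ.* t ℤ.* R ℤ.* (Pᵉ ℤ.* Pᵉ)
          lemma = solve-ℤ
          h²R≡ : h ℤ.* h ℤ.* R ≡ t ℤ.* t ℤ.* R ℤ.* + (p ^ e * p ^ e)
          h²R≡ = trans (lemma t Pᵉ R) (cong (t ℤ.* t ℤ.* R ℤ.*_) (sym (ℤ.pos-* (p ^ e) (p ^ e))))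
          pᵏ⁺¹⁺ᵉ∣p²ᵉ : p ^ (k + suc e) ∣ p ^ e * p ^ e
          pᵏ⁺¹⁺ᵉ∣p²ᵉ = subst (p ^ (k + suc e) ∣_) (^-distribˡ-+-* p e e)
            (^-∣-^ p (subst (_≤ e + e) (sym (+-suc k e)) (+-monoˡ-≤ e k<e)))
      p∤X+h : ¬ p ∣ ℤ.∣ X ℤ.+ h ∣
      p∤X+h = p∤X ∘ ∣-cong-mod {x = X} {y = X ℤ.+ h} (≡-mod-∣ p∣pᵉ (≡-mod (ℤ.- t) (lemma X t Pᵉ)))
        where
          p∣pᵉ : p ∣ p ^ e
          p∣pᵉ = ∣-trans (∣m⇒∣m*n (p ^ k) ∣-refl) (^-∣-^ p k<e)
          lemma : ∀ X t Pᵉ → X ℤ.- (X ℤ.+ t ℤ.* Pᵉ) ≡ ℤ.- t ℤ.* Pᵉ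
          lemma = solve-ℤ

  lift : ∀ X → ¬ p ∣ ℤ.∣ X ∣ → X ℤ.^ suc n₁ ≡ C mod p ^ (k + suc k) →
         ∀ j → ∃[ X′ ] ¬ p ∣ ℤ.∣ X′ ∣ × X′ ℤ.^ suc n₁ ≡ C mod p ^ (k + (j + suc k))
  lift X p∤X Xⁿ≡C zero = X , p∤X , Xⁿ≡C
  lift X p∤X Xⁿ≡C (suc j) with lift X p∤X Xⁿ≡C j
  ... | X′ , p∤X′ , X′ⁿ≡C = step X′ (m≤n+m (suc k) j) p∤X′ X′ⁿ≡C

  hensel : ∀ X → ¬ p ∣ ℤ.∣ X ∣ → X ℤ.^ suc n₁ ≡ C mod p ^ (2 * k + 1) →
           ∀ ℓ → ∃[ X′ ] X′ ℤ.^ suc n₁ ≡ C mod p ^ ℓ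
  hensel X p∤X Xⁿ≡C ℓ with lift X p∤X (subst (λ e → X ℤ.^ suc n₁ ≡ C mod p ^ e) (lemma k) Xⁿ≡C) ℓ
    where
      lemma : ∀ k → 2 * k + 1 ≡ k + suc k
      lemma = solve-ℕ
  ... | X′ , _ , X′ⁿ≡C = X′ , ≡-mod-∣ (^-∣-^ p (≤-trans (m≤m+n ℓ (suc k)) (m≤n+m _ k))) X′ⁿ≡C

natural-solution : ∀ {n N T} .{{_ : NonZero N}} → ∃[ X ] X ℤ.^ n ≡ T ℤ.- + 1 mod N →
  ∃[ x ] + (x ^ n + 1) ≡ T mod N
natural-solution {n} {N} {T} (X , Xⁿ≡T-1) with ∃-representative {N} X
... | x , X≡x = x , (begin
  + (x ^ n + 1)         ≡⟨ power-plus-one {n} x ⟨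
  (+ x) ℤ.^ n ℤ.+ + 1   ≈⟨ ≡-mod-+ (≡-mod-^ n X≡x) (≡-mod-refl {x = + 1}) ⟨
  X ℤ.^ n ℤ.+ + 1       ≈⟨ ≡-mod-add-one Xⁿ≡T-1 ⟩
  T                     ∎)
  where open ≡-mod-Reasoning N

-- p-adic distance between rationals

cross-difference : ℕ → ℕ → ℚ → ℤ
cross-difference a b q = + a ℤ.* ↧ q ℤ.- ↥ q ℤ.* + b

toℚᵘ-/-sub : ∀ a b .{{_ : NonZero b}} q → toℚᵘ ((+ a /ℚ b) -ℚ q) ℚᵘ.≃ (+ a ℚᵘ./ b) ℚᵘ.- toℚᵘ q
toℚᵘ-/-sub a (suc b) q = ℚᵘ.≃-trans (ℚ.toℚᵘ-homo-+ (+ a /ℚ suc b) (ℚ.- q))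
  (ℚᵘ.+-cong (ℚ.toℚᵘ-fromℚᵘ (+ a ℚᵘ./ suc b)) (ℚ.toℚᵘ-homo‿- q))

↥-/-sub : ∀ a b .{{_ : NonZero b}} q →
  ↥ ((+ a /ℚ b) -ℚ q) ℤ.* + (b * ↧ₙ q) ≡ cross-difference a b q ℤ.* ↧ ((+ a /ℚ b) -ℚ q)
↥-/-sub a b@(suc _) q@(mkℚ u d _) with toℚᵘ-/-sub a b q
... | ℚᵘ.*≡* eq = begin
  ↥ x ℤ.* + (b * suc d)                                   ≡⟨ cong (ℤ._* + (b * suc d)) (ℚ.↥ᵘ-toℚᵘ x) ⟨
  ℚᵘ.↥ (toℚᵘ x) ℤ.* + (b * suc d)                         ≡⟨ eq ⟩
  (+ a ℤ.* + suc d ℤ.+ ℤ.- u ℤ.* + b) ℤ.* ℚᵘ.↧ (toℚᵘ x)   ≡⟨ cong₂ ℤ._*_ (lemma (+ a) (+ suc d) u (+ b)) (ℚ.↧ᵘ-toℚᵘ x) ⟩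
  cross-difference a b q ℤ.* ↧ x                          ∎
  where
    open ≡-Reasoning
    x = (+ a /ℚ b) -ℚ q
    lemma : ∀ a d u b → a ℤ.* d ℤ.+ ℤ.- u ℤ.* b ≡ a ℤ.* d ℤ.- u ℤ.* b
    lemma = solve-ℤ

∣↥∣-/-sub : ∀ a b .{{_ : NonZero b}} q →
  ℤ.∣ ↥ ((+ a /ℚ b) -ℚ q) ∣ * (b * ↧ₙ q) ≡ ℤ.∣ cross-difference a b q ∣ * ↧ₙ ((+ a /ℚ b) -ℚ q)
∣↥∣-/-sub a b q = begin
  ℤ.∣ ↥ x ∣ * (b * ↧ₙ q)                     ≡⟨ ℤ.abs-* (↥ x) (+ (b * ↧ₙ q)) ⟨
  ℤ.∣ ↥ x ℤ.* + (b * ↧ₙ q) ∣                 ≡⟨ cong ℤ.∣_∣ (↥-/-sub a b q) ⟩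
  ℤ.∣ cross-difference a b q ℤ.* ↧ x ∣        ≡⟨ ℤ.abs-* (cross-difference a b q) (↧ x) ⟩
  ℤ.∣ cross-difference a b q ∣ * ↧ₙ x         ∎
  where
    open ≡-Reasoning
    x = (+ a /ℚ b) -ℚ q

coprime-↥-↧ : ∀ x → Coprime ℤ.∣ ↥ x ∣ (↧ₙ x)
coprime-↥-↧ (mkℚ _ _ c) = Coprime.recompute c

ValGe⇔cross-multiple : ∀ {p s B} m x Δ → Prime p → ℤ.∣ ↥ x ∣ * B ≡ Δ * ↧ₙ x → p ^ s ∥ B →
  ValGe p m x ⇔ p ^ (m + s) ∣ Δ
ValGe⇔cross-multiple {p} {s} m x Δ pr NB≡Δ↧x (mk∥ Y refl p∤Y) = mk⇔ to from
  where
    N = ℤ.∣ ↥ x ∣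
    pᵐ⁺ˢ≡pᵐpˢ : p ^ (m + s) ≡ p ^ m * p ^ s
    pᵐ⁺ˢ≡pᵐpˢ = ^-distribˡ-+-* p m s
    shuffle : ∀ N P Y → N * (P * Y) ≡ P * (N * Y)
    shuffle = solve-ℕ
    pˢ∣Δ↧x⇒∣NY : ∀ {d} → p ^ s * d ∣ Δ * ↧ₙ x → d ∣ N * Y
    pˢ∣Δ↧x⇒∣NY {d} d∣ = *-cancelˡ-∣ (p ^ s) {{m^n≢0 p s {{prime⇒nonZero pr}}}}
      (subst (p ^ s * d ∣_) (trans (sym NB≡Δ↧x) (shuffle N (p ^ s) Y)) d∣)

    to : ValGe p m x → p ^ (m + s) ∣ Δ
    to (pᵐ∣N , p∤↧x) = coprime-divisor (coprime-^ (m + s) (prime∤⇒coprime pr p∤↧x))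
      (subst (p ^ (m + s) ∣_) (trans NB≡Δ↧x (*-comm Δ (↧ₙ x)))
        (subst (_∣ N * (p ^ s * Y)) (sym pᵐ⁺ˢ≡pᵐpˢ) (*-pres-∣ pᵐ∣N (∣m⇒∣m*n Y ∣-refl))))

    from : p ^ (m + s) ∣ Δ → ValGe p m x
    from pᵐ⁺ˢ∣Δ = pᵐ∣N , p∤↧x
      where
        pᵐ∣N : p ^ m ∣ N
        pᵐ∣N = coprime-divisor (coprime-^ m (prime∤⇒coprime pr p∤Y))
          (subst (p ^ m ∣_) (*-comm N Y) (pˢ∣Δ↧x⇒∣NY
            (subst (_∣ Δ * ↧ₙ x) (trans pᵐ⁺ˢ≡pᵐpˢ (*-comm (p ^ m) (p ^ s))) (∣m⇒∣m*n (↧ₙ x) pᵐ⁺ˢ∣Δ))))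
        p∤↧x : ¬ p ∣ ↧ₙ x
        p∤↧x p∣↧x = prime≢1 pr (coprime-↥-↧ x (p∣N , p∣↧x))
          where
            p∣NY : p ∣ N * Y
            p∣NY = pˢ∣Δ↧x⇒∣NY (*-pres-∣ (∣-trans (^-∣-^ p (m≤n+m s m)) pᵐ⁺ˢ∣Δ) p∣↧x)
            p∣N : p ∣ N
            p∣N with euclidsLemma N Y pr p∣NY
            ... | inj₁ p∣N = p∣N
            ... | inj₂ p∣Y = ⊥-elim (p∤Y p∣Y)

ValGe-of-approximants : ∀ {p M t ℓ} m a b q → Prime p → p ^ t ∥ ↧ₙ q →
  M + t < ℓ → m + (M + t + t) ≤ ℓ →
  + a ≡ + (p ^ M) ℤ.* ↥ q mod p ^ ℓ → + b ≡ + (p ^ M) ℤ.* ↧ q mod p ^ ℓ →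
  Σ (NonZero b) λ nz → ValGe p m ((+ a /ℚ b) {{nz}} -ℚ q)
ValGe-of-approximants {p} {M} {t} {ℓ} m a b q pr pᵗ∥↧q M+t<ℓ m+s≤ℓ a≡pᴹ↥q b≡pᴹ↧q =
  b≢0 , Equivalence.from (ValGe⇔cross-multiple m ((+ a /ℚ b) -ℚ q) _ pr (∣↥∣-/-sub a b q) pᴹ⁺²ᵗ∥b↧q)
          (∣-trans (^-∣-^ p m+s≤ℓ) (≡0-mod⇒∣ℤ Δ≡0))
  where
    pᴹ⁺ᵗ∥b : p ^ (M + t) ∥ b
    pᴹ⁺ᵗ∥b = ∥-cong pr M+t<ℓ (≡-mod-trans b≡pᴹ↧q (≡-mod-reflexive (sym (ℤ.pos-* (p ^ M) (↧ₙ q)))))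
      (∥-* pr (^-∥ M pr) pᵗ∥↧q)
    pᴹ⁺²ᵗ∥b↧q : p ^ (M + t + t) ∥ b * ↧ₙ q
    pᴹ⁺²ᵗ∥b↧q = ∥-* pr pᴹ⁺ᵗ∥b pᵗ∥↧q
    instance
      b≢0 : NonZero b
      b≢0 = ≢-nonZero (∥⇒≢0 pr pᴹ⁺ᵗ∥b)
    P = + (p ^ M)
    Δ≡0 : cross-difference a b q ≡ + 0 mod p ^ ℓ
    Δ≡0 = begin
      + a ℤ.* ↧ q ℤ.- ↥ q ℤ.* + b
        ≈⟨ ≡-mod-- (≡-mod-* a≡pᴹ↥q (≡-mod-refl {x = ↧ q})) (≡-mod-* (≡-mod-refl {x = ↥ q}) b≡pᴹ↧q) ⟩
      P ℤ.* ↥ q ℤ.* ↧ q ℤ.- ↥ q ℤ.* (P ℤ.* ↧ q)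
        ≡⟨ lemma P (↥ q) (↧ q) ⟩
      + 0 ∎
      where
        open ≡-mod-Reasoning (p ^ ℓ)
        lemma : ∀ P u v → P ℤ.* u ℤ.* v ℤ.- u ℤ.* (P ℤ.* v) ≡ + 0
        lemma = solve-ℤ


fromℕ : ℕ → ℚ
fromℕ c = mkℚ (+ c) 0 (Coprime.sym (1-coprimeTo c))

ValGe-fromℕ⇒≡-mod : ∀ {p s} m a b c .{{_ : NonZero b}} → Prime p → p ^ s ∥ b →
  ValGe p m ((+ a /ℚ b) -ℚ fromℕ c) → + a ≡ + (c * b) mod p ^ (m + s)
ValGe-fromℕ⇒≡-mod {p} {s} m a b c pr pˢ∥b valGe = begin
  + a             ≡⟨ ℤ.*-identityʳ (+ a) ⟨
  + a ℤ.* + 1     ≈⟨ ∣⇒≡-mod Δ-divisible ⟩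
  + c ℤ.* + b     ≡⟨ ℤ.pos-* c b ⟨
  + (c * b)       ∎
  where
    open ≡-mod-Reasoning (p ^ (m + s))
    Δ-divisible : p ^ (m + s) ∣ ℤ.∣ cross-difference a b (fromℕ c) ∣
    Δ-divisible = Equivalence.to (ValGe⇔cross-multiple m ((+ a /ℚ b) -ℚ fromℕ c) _ pr
      (∣↥∣-/-sub a b (fromℕ c)) (subst (p ^ s ∥_) (sym (*-identityʳ b)) pˢ∥b)) valGe

-- Density from a root of -1

module _ {p k n₁ n′ : ℕ} (pr : Prime p) (n≡pᵏn′ : suc n₁ ≡ p ^ k * n′) (p∤n′ : ¬ p ∣ n′) where

  private
    n = suc n₁
    M = 2 * k + 1

  ∃-power-plus-one≡ : MinusOneIsNthPowerMod n (p ^ M) →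
    ∀ T → T ≡ + 0 mod p ^ M → ∀ ℓ → ∃[ x ] + (x ^ n + 1) ≡ T mod p ^ ℓ
  ∃-power-plus-one≡ (z₀ , pᴹ∣z₀ⁿ+1) T T≡0 ℓ =
    natural-solution {n} {{m^n≢0 p ℓ {{prime⇒nonZero pr}}}}
      (Hensel.hensel {k = k} pr n≡pᵏn′ p∤n′ (T ℤ.- + 1) (+ z₀) p∤z₀ z₀ⁿ≡T-1 ℓ)
    where
      z₀ⁿ+1≡0 : (+ z₀) ℤ.^ n ℤ.+ + 1 ≡ + 0 mod p ^ M
      z₀ⁿ+1≡0 = ≡-mod-trans (≡-mod-reflexive (power-plus-one {n} z₀)) (∣⇒≡0-mod pᴹ∣z₀ⁿ+1)
      z₀ⁿ≡T-1 : (+ z₀) ℤ.^ n ≡ T ℤ.- + 1 mod p ^ M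
      z₀ⁿ≡T-1 = ≡-mod-sub-one (≡-mod-trans z₀ⁿ+1≡0 (≡-mod-sym T≡0))
      p∤z₀ : ¬ p ∣ z₀
      p∤z₀ p∣z₀ = prime∤1 pr (∣m+n∣m⇒∣n p∣z₀ⁿ+1 (∣m⇒∣m*n (z₀ ^ n₁) p∣z₀))
        where
          p∣z₀ⁿ+1 : p ∣ z₀ ^ n + 1
          p∣z₀ⁿ+1 = ∣-trans (∣m⇒∣m*n (p ^ (2 * k)) ∣-refl)
            (subst (_∣ z₀ ^ n + 1) (cong (p ^_) (+-comm (2 * k) 1)) pᴹ∣z₀ⁿ+1)

  -- With p^t ∥ ↧q, the denominator b ≈ p^M ↧q has valuation M + t, and the precision ℓ exceeds
  -- m + ν_p(b ↧q) = m + M + 2t.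
  MinusOneIsNthPowerMod⇒DenseInQp : MinusOneIsNthPowerMod n (p ^ M) → DenseInQp n p
  MinusOneIsNthPowerMod⇒DenseInQp witness q m =
    xa ^ n + 1 , xb ^ n + 1 , sum-of-powers xa , sum-of-powers xb ,
    ValGe-of-approximants m (xa ^ n + 1) (xb ^ n + 1) q pr pᵗ∥↧q
      (s≤s (≤-trans (m≤m+n (M + t) t) (m≤n+m _ m))) (n≤1+n _) a≡pᴹ↥q b≡pᴹ↧q
    where
      t = proj₁ (∃-∥ {x = ↧ₙ q} pr (λ ()))
      pᵗ∥↧q : p ^ t ∥ ↧ₙ q
      pᵗ∥↧q = proj₂ (∃-∥ {x = ↧ₙ q} pr (λ ()))
      ℓ = suc (m + (M + t + t))
      approximate : ∀ u → ∃[ x ] + (x ^ n + 1) ≡ + (p ^ M) ℤ.* u mod p ^ ℓ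
      approximate u = ∃-power-plus-one≡ witness (+ (p ^ M) ℤ.* u)
        (≡-mod-trans (≡-mod-reflexive (ℤ.*-comm (+ (p ^ M)) u)) (multiple≡0-mod u ∣-refl)) ℓ
      xa = proj₁ (approximate (↥ q))
      a≡pᴹ↥q : + (xa ^ n + 1) ≡ + (p ^ M) ℤ.* ↥ q mod p ^ ℓ
      a≡pᴹ↥q = proj₂ (approximate (↥ q))
      xb = proj₁ (approximate (↧ q))
      b≡pᴹ↧q : + (xb ^ n + 1) ≡ + (p ^ M) ℤ.* ↧ q mod p ^ ℓ
      b≡pᴹ↧q = proj₂ (approximate (↧ q))
      sum-of-powers : ∀ x → InS2 n (x ^ n + 1)
      sum-of-powers x = x , 1 , cong (_+_ (x ^ n)) (sym (^-zeroˡ n))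

even-or-odd : ∀ n → ∃[ i ] (n ≡ 2 * i ⊎ n ≡ 1 + 2 * i)
even-or-odd zero = 0 , inj₁ refl
even-or-odd (suc n) with even-or-odd n
... | i , inj₁ n≡2i = i , inj₂ (cong suc n≡2i)
... | i , inj₂ n≡1+2i = suc i , inj₁ (trans (cong suc n≡1+2i) (lemma i))
  where
    lemma : ∀ i → 2 + 2 * i ≡ 2 * suc i
    lemma = solve-ℕ

2∣2* : ∀ i → 2 ∣ 2 * i
2∣2* i = divides i (*-comm 2 i)

2∤1+2* : ∀ i → ¬ 2 ∣ 1 + 2 * i
2∤1+2* i (divides q 1+2i≡2q) = even≢odd q i (sym (trans 1+2i≡2q (*-comm q 2)))

2∤1+4* : ∀ i → ¬ 2 ∣ 1 + 4 * i
2∤1+4* i = subst (λ m → ¬ 2 ∣ 1 + m) (sym (*-assoc 2 2 i)) (2∤1+2* (2 * i))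

-1^odd : ∀ i → (ℤ.- + 1) ℤ.^ (1 + 2 * i) ≡ ℤ.- + 1
-1^odd zero    = refl
-1^odd (suc i) = trans (cong ((ℤ.- + 1) ℤ.^_) (lemma i))
                       (cong (λ x → ℤ.- + 1 ℤ.* (ℤ.- + 1 ℤ.* x)) (-1^odd i))
  where
    lemma : ∀ i → 1 + 2 * suc i ≡ 2 + (1 + 2 * i)
    lemma = solve-ℕ

pred≡-1-mod : ∀ N .{{_ : NonZero N}} → + (N ∸ 1) ≡ ℤ.- + 1 mod N
pred≡-1-mod N = ≡-mod (+ 1) (begin
  + (N ∸ 1) ℤ.- ℤ.- + 1   ≡⟨ lemma (+ (N ∸ 1)) ⟩
  + (N ∸ 1) ℤ.+ + 1       ≡⟨ ℤ.pos-+ (N ∸ 1) 1 ⟨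
  + (N ∸ 1 + 1)           ≡⟨ cong +_ (m∸n+n≡m (n≢0⇒n>0 (≢-nonZero⁻¹ N))) ⟩
  + N                     ≡⟨ ℤ.*-identityˡ (+ N) ⟨
  + 1 ℤ.* + N             ∎)
  where
    open ≡-Reasoning
    lemma : ∀ x → x ℤ.- ℤ.- + 1 ≡ x ℤ.+ + 1
    lemma = solve-ℤ

odd⇒MinusOneIsNthPowerMod : ∀ {n} N .{{_ : NonZero N}} → ¬ 2 ∣ n → MinusOneIsNthPowerMod n N
odd⇒MinusOneIsNthPowerMod {n} N n-odd with even-or-odd n
... | i , inj₁ refl = ⊥-elim (n-odd (2∣2* i))
... | i , inj₂ refl = N ∸ 1 , ≡0-mod⇒∣ℤ (begin
  + ((N ∸ 1) ^ n + 1)         ≡⟨ power-plus-one {n} (N ∸ 1) ⟨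
  (+ (N ∸ 1)) ℤ.^ n ℤ.+ + 1   ≈⟨ ≡-mod-+ (≡-mod-^ n (pred≡-1-mod N)) (≡-mod-refl {x = + 1}) ⟩
  (ℤ.- + 1) ℤ.^ n ℤ.+ + 1     ≡⟨ cong (ℤ._+ + 1) (-1^odd i) ⟩
  ℤ.- + 1 ℤ.+ + 1             ≡⟨ ℤ.+-inverseˡ (+ 1) ⟩
  + 0                         ∎)
  where open ≡-mod-Reasoning N

-- Even exponents and odd primes

unit-sum⇒MinusOneIsNthPowerMod : ∀ {p N y₁ y₂} n → Prime p → ¬ p ∣ y₁ →
  p ^ N ∣ y₁ ^ n + y₂ ^ n → MinusOneIsNthPowerMod n (p ^ N)
unit-sum⇒MinusOneIsNthPowerMod {p} {N} {y₁} {y₂} n pr p∤y₁ pᴺ∣sum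
  with unit-inverse {G = + y₁} pr p∤y₁ N
... | c , y₁c≡1 with ∃-representative {p ^ N} {{m^n≢0 p N {{prime⇒nonZero pr}}}} (+ y₂ ℤ.* c)
... | z , y₂c≡z = z , ≡0-mod⇒∣ℤ (begin
  + (z ^ n + 1)                               ≡⟨ power-plus-one {n} z ⟨
  (+ z) ℤ.^ n ℤ.+ + 1                         ≈⟨ ≡-mod-+ (≡-mod-^ n y₂c≡z) y₁cⁿ≡1 ⟨
  (+ y₂ ℤ.* c) ℤ.^ n ℤ.+ (+ y₁ ℤ.* c) ℤ.^ n   ≡⟨ factor ⟩
  c ℤ.^ n ℤ.* (Y₁ ℤ.+ Y₂)                     ≈⟨ ≡-mod-* (≡-mod-refl {x = c ℤ.^ n}) sum≡0 ⟩
  c ℤ.^ n ℤ.* + 0                             ≡⟨ ℤ.*-zeroʳ (c ℤ.^ n) ⟩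
  + 0                                         ∎)
  where
    open ≡-mod-Reasoning (p ^ N)
    Y₁ = (+ y₁) ℤ.^ n
    Y₂ = (+ y₂) ℤ.^ n
    y₁cⁿ≡1 : (+ y₁ ℤ.* c) ℤ.^ n ≡ + 1 mod p ^ N
    y₁cⁿ≡1 = ≡-mod-trans (≡-mod-^ n y₁c≡1) (≡-mod-reflexive (ℤ.^-zeroˡ n))
    sum≡0 : Y₁ ℤ.+ Y₂ ≡ + 0 mod p ^ N
    sum≡0 = ≡-mod-trans (≡-mod-reflexive Y₁+Y₂≡) (∣⇒≡0-mod pᴺ∣sum)
      where
        Y₁+Y₂≡ : Y₁ ℤ.+ Y₂ ≡ + (y₁ ^ n + y₂ ^ n)
        Y₁+Y₂≡ = sym (trans (ℤ.pos-+ (y₁ ^ n) (y₂ ^ n)) (cong₂ ℤ._+_ (pos-^ y₁ n) (pos-^ y₂ n)))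
    factor : (+ y₂ ℤ.* c) ℤ.^ n ℤ.+ (+ y₁ ℤ.* c) ℤ.^ n ≡ c ℤ.^ n ℤ.* (Y₁ ℤ.+ Y₂)
    factor = trans (cong₂ ℤ._+_ (ℤ^-distribʳ-* (+ y₂) c n) (ℤ^-distribʳ-* (+ y₁) c n))
                   (lemma Y₁ Y₂ (c ℤ.^ n))
      where
        lemma : ∀ A B C → B ℤ.* C ℤ.+ A ℤ.* C ≡ C ℤ.* (A ℤ.+ B)
        lemma = solve-ℤ

S2-valuation : ∀ {p n₁ a} → Prime p → ∀ N → InS2 (suc n₁) a → a ≢ 0 →
  MinusOneIsNthPowerMod (suc n₁) (p ^ N) ⊎ ∃[ v ] ∃[ r ] r < N × p ^ (suc n₁ * v + r) ∥ a
S2-valuation {p} {n₁} {a} pr N (x₁ , x₂ , a≡) a≢0 = factor-out (common-power pr x₁ x₂ x₁+x₂≢0)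
  where
    n = suc n₁
    x₁+x₂≢0 : x₁ + x₂ ≢ 0
    x₁+x₂≢0 eq = a≢0 (trans a≡ (cong₂ (λ y₁ y₂ → y₁ ^ n + y₂ ^ n) (m+n≡0⇒m≡0 x₁ eq) (m+n≡0⇒n≡0 x₁ eq)))
    factor-out : ∃[ v ] ∃[ y₁ ] ∃[ y₂ ] x₁ ≡ p ^ v * y₁ × x₂ ≡ p ^ v * y₂ × (¬ p ∣ y₁ ⊎ ¬ p ∣ y₂) →
      MinusOneIsNthPowerMod n (p ^ N) ⊎ ∃[ v ] ∃[ r ] r < N × p ^ (n * v + r) ∥ a
    factor-out (v , y₁ , y₂ , refl , refl , p∤y₁⊎p∤y₂) = classify (∃-∥ pr A≢0)
      where
        A = y₁ ^ n + y₂ ^ n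
        pᵛy≡ : ∀ y → (p ^ v * y) ^ n ≡ p ^ (n * v) * y ^ n
        pᵛy≡ y = trans (^-distribʳ-* (p ^ v) y n) (cong (_* y ^ n) (trans (^-*-assoc p v n) (cong (p ^_) (*-comm v n))))
        a≡pⁿᵛA : _ ≡ p ^ (n * v) * A
        a≡pⁿᵛA = trans a≡ (trans (cong₂ _+_ (pᵛy≡ y₁) (pᵛy≡ y₂)) (sym (*-distribˡ-+ (p ^ (n * v)) (y₁ ^ n) (y₂ ^ n))))
        A≢0 : A ≢ 0
        A≢0 A≡0 = a≢0 (trans a≡pⁿᵛA (trans (cong (p ^ (n * v) *_) A≡0) (*-zeroʳ (p ^ (n * v)))))
        unit-part : p ^ N ∣ A → (¬ p ∣ y₁ ⊎ ¬ p ∣ y₂) → MinusOneIsNthPowerMod n (p ^ N)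
        unit-part pᴺ∣A (inj₁ p∤y₁) = unit-sum⇒MinusOneIsNthPowerMod {N = N} {y₂ = y₂} n pr p∤y₁ pᴺ∣A
        unit-part pᴺ∣A (inj₂ p∤y₂) =
          unit-sum⇒MinusOneIsNthPowerMod {N = N} {y₂ = y₁} n pr p∤y₂ (subst (p ^ N ∣_) (+-comm (y₁ ^ n) (y₂ ^ n)) pᴺ∣A)
        classify : ∃[ r ] p ^ r ∥ A → MinusOneIsNthPowerMod n (p ^ N) ⊎ ∃[ v ] ∃[ r ] r < N × p ^ (n * v + r) ∥ a
        classify (r , pʳ∥A) with r <? N
        ... | yes r<N = inj₂ (v , r , r<N , subst (p ^ (n * v + r) ∥_) (sym a≡pⁿᵛA) (∥-* pr (^-∥ (n * v) pr) pʳ∥A))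
        ... | no r≮N = inj₁ (unit-part (∣-trans (^-∣-^ p (≮⇒≥ r≮N)) (∥⇒∣ pʳ∥A)) p∤y₁⊎p∤y₂)

remainder-unique : ∀ {n v v′ r r′} → n * v + r ≡ n * v′ + r′ → r < n → r′ < n → r ≡ r′
remainder-unique {n@(suc _)} {v} {v′} {r} {r′} eq r<n r′<n = begin
  r                    ≡⟨ m<n⇒m%n≡m r<n ⟨
  r % n                ≡⟨ [m+kn]%n≡m%n r v n ⟨
  (r + v * n) % n      ≡⟨ cong (_% n) (trans (lemma r v n) (trans eq (sym (lemma r′ v′ n)))) ⟩
  (r′ + v′ * n) % n    ≡⟨ [m+kn]%n≡m%n r′ v′ n ⟩
  r′ % n               ≡⟨ m<n⇒m%n≡m r′<n ⟩
  r′                   ∎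
  where
    open ≡-Reasoning
    lemma : ∀ r v n → r + v * n ≡ n * v + r
    lemma = solve-ℕ

-- Approximating p^N to precision p^(N+1) forces ν_p(a) = N + ν_p(b).  Without a root of -1
-- both valuations are nv + r with r < N, and 2N ≤ n makes N + r_b a remainder mod n as well.
DenseInQp⇒MinusOneIsNthPowerMod : ∀ {p n₁} N → Prime p → 2 * N ≤ suc n₁ → DenseInQp (suc n₁) p →
  MinusOneIsNthPowerMod (suc n₁) (p ^ N)
DenseInQp⇒MinusOneIsNthPowerMod {p} {n₁} N pr 2N≤n dense = approximant (dense (fromℕ (p ^ N)) (suc N))
  where
    n = suc n₁
    instance _ = prime⇒nonZero pr
    approximant : Σ ℕ (λ a → Σ ℕ λ b → InS2 n a × InS2 n b ×
                    Σ (NonZero b) λ nz → ValGe p (suc N) ((+ a /ℚ b) {{nz}} -ℚ fromℕ (p ^ N))) →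
                  MinusOneIsNthPowerMod n (p ^ N)
    approximant (a , b , a∈S , b∈S , nz , valGe) =
      compare (S2-valuation {n₁ = n₁} pr N a∈S a≢0) (S2-valuation {n₁ = n₁} pr N b∈S b≢0)
      where
        b≢0 : b ≢ 0
        b≢0 = ≢-nonZero⁻¹ b {{nz}}
        s = proj₁ (∃-∥ pr b≢0)
        pˢ∥b : p ^ s ∥ b
        pˢ∥b = proj₂ (∃-∥ pr b≢0)
        pᴺ⁺ˢ∥a : p ^ (N + s) ∥ a
        pᴺ⁺ˢ∥a = ∥-cong pr ≤-refl (ValGe-fromℕ⇒≡-mod (suc N) a b (p ^ N) {{nz}} pr pˢ∥b valGe)
                   (∥-* pr (^-∥ N pr) pˢ∥b)
        a≢0 : a ≢ 0
        a≢0 = ∥⇒≢0 pr pᴺ⁺ˢ∥a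
        compare : MinusOneIsNthPowerMod n (p ^ N) ⊎ ∃[ v ] ∃[ r ] r < N × p ^ (n * v + r) ∥ a →
                  MinusOneIsNthPowerMod n (p ^ N) ⊎ ∃[ v ] ∃[ r ] r < N × p ^ (n * v + r) ∥ b →
                  MinusOneIsNthPowerMod n (p ^ N)
        compare (inj₁ witness) _ = witness
        compare (inj₂ _) (inj₁ witness) = witness
        compare (inj₂ (va , ra , ra<N , ∥a)) (inj₂ (vb , rb , rb<N , ∥b)) = ⊥-elim (<⇒≱ ra<N N≤ra)
          where
            N≤n : N + N ≤ n
            N≤n = subst (_≤ n) (cong (_+_ N) (+-identityʳ N)) 2N≤n
            shuffle : ∀ N m r → N + (m + r) ≡ m + (N + r)
            shuffle = solve-ℕ
            exponents : n * va + ra ≡ n * vb + (N + rb)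
            exponents = trans (∥-unique ∥a pᴺ⁺ˢ∥a) (trans (cong (_+_ N) (∥-unique pˢ∥b ∥b)) (shuffle N (n * vb) rb))
            N≤ra : N ≤ ra
            N≤ra = subst (N ≤_) (sym (remainder-unique {n} {va} {vb} exponents (<-≤-trans ra<N (≤-trans (m≤m+n N N) N≤n))
                                                                 (<-≤-trans (+-monoʳ-< N rb<N) N≤n)))
                         (m≤m+n N rb)

2k+1≤3^k : ∀ k → 2 * k + 1 ≤ 3 ^ k
2k+1≤3^k zero    = ≤-refl
2k+1≤3^k (suc k) = begin
  2 * suc k + 1      ≡⟨ lemma₁ k ⟩
  2 * k + 1 + 2      ≤⟨ +-mono-≤ (2k+1≤3^k k) (*-monoʳ-≤ 2 (m^n>0 3 k)) ⟩
  3 ^ k + 2 * 3 ^ k  ≡⟨ lemma₂ (3 ^ k) ⟩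
  3 ^ suc k          ∎
  where
    open ≤-Reasoning
    lemma₁ : ∀ k → 2 * suc k + 1 ≡ 2 * k + 1 + 2
    lemma₁ = solve-ℕ
    lemma₂ : ∀ x → x + 2 * x ≡ 3 * x
    lemma₂ = solve-ℕ

even-multiple-of-odd-prime-power : ∀ {p} k n′ → Prime p → p ≢ 2 → 2 ∣ p ^ k * n′ → p ^ k * n′ ≢ 0 →
  2 * (2 * k + 1) ≤ p ^ k * n′
even-multiple-of-odd-prime-power {p} k n′ pr p≢2 2∣n n≢0 = begin
  2 * (2 * k + 1)    ≡⟨ *-comm 2 (2 * k + 1) ⟩
  (2 * k + 1) * 2    ≤⟨ *-mono-≤ (≤-trans (2k+1≤3^k k) (^-monoˡ-≤ k 3≤p)) 2≤n′ ⟩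
  p ^ k * n′         ∎
  where
    open ≤-Reasoning
    3≤p : 3 ≤ p
    3≤p = ≤∧≢⇒< (prime⇒>1 pr) (p≢2 ∘ sym)
    2∤p : ¬ 2 ∣ p
    2∤p 2∣p with prime⇒irreducible pr 2∣p
    ... | inj₂ 2≡p = p≢2 (sym 2≡p)
    2∣n′ : 2 ∣ n′
    2∣n′ = coprime-divisor (Coprime.sym (coprime-^ k (Coprime.sym (prime∤⇒coprime prime[2] 2∤p)))) 2∣n
    2≤n′ : 2 ≤ n′
    2≤n′ = ∣⇒≤ {{≢-nonZero n′≢0}} 2∣n′
      where
        n′≢0 : n′ ≢ 0
        n′≢0 n′≡0 = n≢0 (trans (cong (p ^ k *_) n′≡0) (*-zeroʳ (p ^ k)))

-- Even exponents and p = 2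

odd-square : ∀ i → ∃[ j ] (1 + 2 * i) * (1 + 2 * i) ≡ 1 + 8 * j
odd-square i with even-or-odd i
... | c , inj₁ refl = c + 2 * c * c , lemma c
  where
    lemma : ∀ c → (1 + 2 * (2 * c)) * (1 + 2 * (2 * c)) ≡ 1 + 8 * (c + 2 * c * c)
    lemma = solve-ℕ
... | c , inj₂ refl = 1 + 3 * c + 2 * c * c , lemma c
  where
    lemma : ∀ c → (1 + 2 * (1 + 2 * c)) * (1 + 2 * (1 + 2 * c)) ≡ 1 + 8 * (1 + 3 * c + 2 * c * c)
    lemma = solve-ℕ

primitive-sum-of-squares : ∀ x y → ¬ 2 ∣ x ⊎ ¬ 2 ∣ y →
  ∃[ i ] (x * x + y * y ≡ 1 + 4 * i ⊎ x * x + y * y ≡ 2 * (1 + 4 * i))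
primitive-sum-of-squares x y x-odd⊎y-odd with even-or-odd x | even-or-odd y
... | i , inj₁ refl | j , inj₁ refl with x-odd⊎y-odd
...   | inj₁ x-odd = ⊥-elim (x-odd (2∣2* i))
...   | inj₂ y-odd = ⊥-elim (y-odd (2∣2* j))
primitive-sum-of-squares x y _ | i , inj₂ refl | j , inj₁ refl with odd-square i
... | k , eq = 2 * k + j * j , inj₁ (trans (cong (_+ 2 * j * (2 * j)) eq) (lemma k j))
  where
    lemma : ∀ k j → 1 + 8 * k + 2 * j * (2 * j) ≡ 1 + 4 * (2 * k + j * j)
    lemma = solve-ℕ
primitive-sum-of-squares x y _ | i , inj₁ refl | j , inj₂ refl with odd-square j
... | k , eq = 2 * k + i * i , inj₁ (trans (cong (_+_ (2 * i * (2 * i))) eq) (lemma k i))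
  where
    lemma : ∀ k i → 2 * i * (2 * i) + (1 + 8 * k) ≡ 1 + 4 * (2 * k + i * i)
    lemma = solve-ℕ
primitive-sum-of-squares x y _ | i , inj₂ refl | j , inj₂ refl with odd-square i | odd-square j
... | k , eq | l , eq′ = k + l , inj₂ (trans (cong₂ _+_ eq eq′) (lemma k l))
  where
    lemma : ∀ k l → 1 + 8 * k + (1 + 8 * l) ≡ 2 * (1 + 4 * (k + l))
    lemma = solve-ℕ

S2-2-adic-form : ∀ {h a} → InS2 (h * 2) a → a ≢ 0 → ∃[ e ] ∃[ i ] a ≡ 2 ^ e * (1 + 4 * i)
S2-2-adic-form {h} {a} (x₁ , x₂ , a≡) a≢0 = factor-out (common-power prime[2] X Y X+Y≢0)
  where
    X = x₁ ^ h
    Y = x₂ ^ h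
    square : ∀ x → x ^ (h * 2) ≡ x ^ h * x ^ h
    square x = trans (sym (^-*-assoc x h 2)) (cong (x ^ h *_) (*-identityʳ (x ^ h)))
    a≡X²+Y² : a ≡ X * X + Y * Y
    a≡X²+Y² = trans a≡ (cong₂ _+_ (square x₁) (square x₂))
    X+Y≢0 : X + Y ≢ 0
    X+Y≢0 eq = a≢0 (trans a≡X²+Y² (cong₂ (λ u w → u * u + w * w) (m+n≡0⇒m≡0 X eq) (m+n≡0⇒n≡0 X eq)))
    a≡2²ᵛ* : ∀ {v y₁ y₂} → X ≡ 2 ^ v * y₁ → Y ≡ 2 ^ v * y₂ → a ≡ 2 ^ (v + v) * (y₁ * y₁ + y₂ * y₂)
    a≡2²ᵛ* {v} {y₁} {y₂} X≡ Y≡ = trans a≡X²+Y² (trans (cong₂ (λ u w → u * u + w * w) X≡ Y≡)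
      (trans (lemma (2 ^ v) y₁ y₂) (cong (_* (y₁ * y₁ + y₂ * y₂)) (sym (^-distribˡ-+-* 2 v v)))))
      where
        lemma : ∀ P y₁ y₂ → P * y₁ * (P * y₁) + P * y₂ * (P * y₂) ≡ P * P * (y₁ * y₁ + y₂ * y₂)
        lemma = solve-ℕ
    factor-out : ∃[ v ] ∃[ y₁ ] ∃[ y₂ ] X ≡ 2 ^ v * y₁ × Y ≡ 2 ^ v * y₂ × (¬ 2 ∣ y₁ ⊎ ¬ 2 ∣ y₂) →
      ∃[ e ] ∃[ i ] a ≡ 2 ^ e * (1 + 4 * i)
    factor-out (v , y₁ , y₂ , X≡ , Y≡ , odd) with primitive-sum-of-squares y₁ y₂ odd
    ... | i , inj₁ eq = v + v , i , trans (a≡2²ᵛ* {v} {y₁} {y₂} X≡ Y≡) (cong (2 ^ (v + v) *_) eq)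
    ... | i , inj₂ eq = suc (v + v) , i ,
      trans (a≡2²ᵛ* {v} {y₁} {y₂} X≡ Y≡) (trans (cong (2 ^ (v + v) *_) eq) (lemma (2 ^ (v + v)) (1 + 4 * i)))
      where
        lemma : ∀ P w → P * (2 * w) ≡ 2 * P * w
        lemma = solve-ℕ

1≢3-mod-4 : ¬ (+ 1 ≡ + 3 mod 4)
1≢3-mod-4 1≡3 = 4≰2 (∣⇒≤ (≡-mod⇒∣ 1≡3))
  where
    4≰2 : ¬ 4 ≤ 2
    4≰2 (s≤s (s≤s ()))

-- Approximating 3 to precision 2² forces a = 2^e u and b = 2^e w with u ≡ 3w (mod 4),
-- whereas both odd parts are 1 mod 4.
¬DenseInQp₂ : ∀ h → ¬ DenseInQp (h * 2) 2
¬DenseInQp₂ h dense = approximant (dense (fromℕ 3) 2)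
  where
    approximant : ¬ (Σ ℕ λ a → Σ ℕ λ b → InS2 (h * 2) a × InS2 (h * 2) b ×
                      Σ (NonZero b) λ nz → ValGe 2 2 ((+ a /ℚ b) {{nz}} -ℚ fromℕ 3))
    approximant (a , b , a∈S , b∈S , nz , valGe) = b-form (S2-2-adic-form {h} b∈S (≢-nonZero⁻¹ b {{nz}}))
      where
        b-form : ¬ (∃[ e ] ∃[ j ] b ≡ 2 ^ e * (1 + 4 * j))
        b-form (e , j , b≡) = a-form (S2-2-adic-form {h} a∈S (∥⇒≢0 prime[2] 2ᵉ∥a))
          where
            2ᵉ∥b : 2 ^ e ∥ b
            2ᵉ∥b = mk∥ (1 + 4 * j) b≡ (2∤1+4* j)
            a≡3b : + a ≡ + (3 * b) mod 2 ^ (2 + e)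
            a≡3b = ValGe-fromℕ⇒≡-mod 2 a b 3 {{nz}} prime[2] 2ᵉ∥b valGe
            2ᵉ∥a : 2 ^ e ∥ a
            2ᵉ∥a = ∥-cong prime[2] (m<n+m e {2} (s≤s z≤n)) a≡3b (∥-* prime[2] (mk∥ 3 refl (2∤1+2* 1)) 2ᵉ∥b)
            3b≡ : 3 * b ≡ 2 ^ e * (3 * (1 + 4 * j))
            3b≡ = trans (cong (3 *_) b≡) (shuffle (2 ^ e) (1 + 4 * j))
              where
                shuffle : ∀ P w → 3 * (P * w) ≡ P * (3 * w)
                shuffle = solve-ℕ
            a-form : ¬ (∃[ e′ ] ∃[ i ] a ≡ 2 ^ e′ * (1 + 4 * i))
            a-form (e′ , i , a≡′) = 1≢3-mod-4 (begin
              + 1                    ≈⟨ +-*-≡-mod 1 4 i ⟨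
              + (1 + 4 * i)          ≈⟨ unit-parts≡ ⟩
              + (3 * (1 + 4 * j))    ≡⟨ cong +_ (lemma j) ⟩
              + (3 + 4 * (3 * j))    ≈⟨ +-*-≡-mod 3 4 (3 * j) ⟩
              + 3                    ∎)
              where
                open ≡-mod-Reasoning 4
                lemma : ∀ j → 3 * (1 + 4 * j) ≡ 3 + 4 * (3 * j)
                lemma = solve-ℕ
                a≡ : a ≡ 2 ^ e * (1 + 4 * i)
                a≡ = subst (λ f → a ≡ 2 ^ f * (1 + 4 * i))
                       (∥-unique {e = e′} {f = e} (mk∥ (1 + 4 * i) a≡′ (2∤1+4* i)) 2ᵉ∥a) a≡′
                unit-parts≡ : + (1 + 4 * i) ≡ + (3 * (1 + 4 * j)) mod 4
                unit-parts≡ = ≡-mod-cancel (2 ^ e) {{m^n≢0 2 e}}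
                  (subst₂ (λ x M → + x ≡ + (2 ^ e * (3 * (1 + 4 * j))) mod M) a≡
                          (trans (^-distribˡ-+-* 2 2 e) (*-comm 4 (2 ^ e)))
                          (≡-mod-trans a≡3b (≡-mod-reflexive (cong +_ 3b≡))))

corollary1p12 : (n p k : ℕ) → 2 ≤ n → Prime p →
    p ^ k ∣ n → ¬ (p ^ suc k ∣ n) →
    (DenseInQp n p ⇔ MinusOneIsNthPowerMod n (p ^ (2 * k + 1)))
    × (¬ (2 ∣ n) → DenseInQp n p)
corollary1p12 zero _ _ () _ _ _
corollary1p12 n@(suc _) p k _ pr (divides n′ n≡n′pᵏ) pᵏ⁺¹∤n =
  mk⇔ (necessary (2 ∣? n) (p ≟ 2)) sufficient , sufficient ∘ odd-witness
  where
    M = 2 * k + 1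
    n≡pᵏn′ : n ≡ p ^ k * n′
    n≡pᵏn′ = trans n≡n′pᵏ (*-comm n′ (p ^ k))
    p∤n′ : ¬ p ∣ n′
    p∤n′ (divides c refl) = pᵏ⁺¹∤n (divides c (trans n≡n′pᵏ (*-assoc c p (p ^ k))))
    sufficient : MinusOneIsNthPowerMod n (p ^ M) → DenseInQp n p
    sufficient = MinusOneIsNthPowerMod⇒DenseInQp {k = k} {n′ = n′} pr n≡pᵏn′ p∤n′
    odd-witness : ¬ 2 ∣ n → MinusOneIsNthPowerMod n (p ^ M)
    odd-witness = odd⇒MinusOneIsNthPowerMod (p ^ M) {{m^n≢0 p M {{prime⇒nonZero pr}}}}
    necessary : Dec (2 ∣ n) → Dec (p ≡ 2) → DenseInQp n p → MinusOneIsNthPowerMod n (p ^ M)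
    necessary (no n-odd) _ _ = odd-witness n-odd
    necessary (yes (divides h n≡h2)) (yes p≡2) dense =
      ⊥-elim (¬DenseInQp₂ h (subst₂ DenseInQp n≡h2 p≡2 dense))
    necessary (yes 2∣n) (no p≢2) = DenseInQp⇒MinusOneIsNthPowerMod M pr 2M≤n
      where
        2M≤n : 2 * M ≤ n
        2M≤n = subst (2 * M ≤_) (sym n≡pᵏn′)
          (even-multiple-of-odd-prime-power k n′ pr p≢2 (subst (2 ∣_) n≡pᵏn′ 2∣n) (1+n≢0 ∘ trans n≡pᵏn′))
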